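{- For all closed $X,Y\in\mathcal C$, the set $Z=\{\Delta\mid\forall\Delta'\in X.\ (\Delta;\Delta')\in Y\}$ is closed and is the Heyting implication of $X$ and $Y$ in $\mathcal C$: for every closed $W$, $W\cap X\subseteq Y$ if and only if $W\subseteq Z$.
   Context: Formulas of BI: $\varphi,\psi ::= \top \mid \bot \mid \varphi\wedge\psi \mid \varphi\vee\psi \mid \varphi\to\psi \mid \mathsf{emp} \mid \varphi * \psi \mid \varphi \mathrel{ -\!\!*} \psi \mid a$ ($a\in\mathrm{Atom}$). Bunches: $\Delta ::= \varphi \mid \varnothing_m \mid \varnothing_a \mid \Delta , \Delta \mid \Delta ; \Delta$. A bunched context $\Delta(-)$ is a bunch with one hole; $\Delta(\Gamma)$ fills it. Bunch equivalence $\equiv$: least equivalence relation, closed under bunched contexts, making "$,$" commutative and associative with unit $\varnothing_m$ and "$;$" commutative and associative with unit $\varnothing_a$. The BI sequent calculus: (ax) $a\vdash a$; (equiv) from $\Delta'\vdash\varphi$, $\Delta\equiv\Delta'$ infer $\Delta\vdash\varphi$; (W;) from $\Delta(\Delta_1)\vdash\varphi$ infer $\Delta(\Delta_1;\Delta_2)\vdash\varphi$; (C;) from $\Delta(\Delta_1;\Delta_1)\vdash\varphi$ infer $\Delta(\Delta_1)\vdash\varphi$; (cut) from $\Delta'\vdash A$, $\Delta(A)\vdash B$ infer $\Delta(\Delta')\vdash B$; (empR) $\varnothing_m\vdash\mathsf{emp}$; (empL) from $\Delta(\varnothing_m)\vdash\varphi$ infer $\Delta(\mathsf{emp})\vdash\varphi$;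 (*R) from $\Delta_1\vdash\varphi$, $\Delta_2\vdash\psi$ infer $\Delta_1,\Delta_2\vdash\varphi*\psi$; (*L) from $\Delta(\varphi,\psi)\vdash\chi$ infer $\Delta(\varphi*\psi)\vdash\chi$; ($-\!*$R) from $\Delta,\varphi\vdash\psi$ infer $\Delta\vdash\varphi\mathrel{ -\!\!*}\psi$; ($-\!*$L) from $\Delta_1\vdash\varphi$, $\Delta(\Delta_2,\psi)\vdash\chi$ infer $\Delta((\Delta_1,\Delta_2),\varphi\mathrel{ -\!\!*}\psi)\vdash\chi$; ($\top$R) $\varnothing_a\vdash\top$; ($\top$L) from $\Delta(\varnothing_a)\vdash\varphi$ infer $\Delta(\top)\vdash\varphi$; ($\wedge$R) from $\Delta_1\vdash\varphi$, $\Delta_2\vdash\psi$ infer $\Delta_1;\Delta_2\vdash\varphi\wedge\psi$; ($\wedge$L) from $\Delta(\varphi;\psi)\vdash\chi$ infer $\Delta(\varphi\wedge\psi)\vdash\chi$; ($\to$R) from $\Delta;\varphi\vdash\psi$ infer $\Delta\vdash\varphi\to\psi$; ($\to$L) from $\Delta_1\vdash\varphi$, $\Delta(\Delta_2;\psi)\vdash\chi$ infer $\Delta((\Delta_1;\Delta_2);\varphi\to\psi)\vdash\chi$; ($\bot$L) $\Delta(\bot)\vdash\varphi$; ($\vee$R1/2) from $\Delta\vdash\varphi$ (resp. $\Delta\vdash\psi$) infer $\Delta\vdash\varphi\vee\psi$; ($\vee$L) from $\Delta(\varphi)\vdash\chi$, $\Delta(\psi)\vdash\chi$ infer $\Delta(\varphi\vee\psi)\vdash\chi$.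 $\Delta\vdash_{\mathsf{cf}}\varphi$ means derivable without (cut). Let $\mathrm{Bunch}$ be the set of bunches modulo $\equiv$; $D(\varphi)=\{\Delta\in\mathrm{Bunch}\mid\Delta\vdash_{\mathsf{cf}}\varphi\}$; for $X\subseteq\mathrm{Bunch}$, $\mathrm{cl}(X)=\bigcap\{D(\varphi)\mid X\subseteq D(\varphi)\}$; $\mathcal C=\{X\subseteq\mathrm{Bunch}\mid X=\mathrm{cl}(X)\}$ is the set of closed sets. -}

module Defs where

open import Data.Nat using (ℕ)
open import Data.Product using (_×_)
open import Relation.Unary using (Pred; _⊆_)
open import Level using (0ℓ)

Atom : Set
Atom = ℕ

infixr 30 _*ᶠ_
infixr 25 _∧ᶠ_ _∨ᶠ_
infixr 20 _→ᶠ_ _-*_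

data Formula : Set where
  ⊤ᶠ ⊥ᶠ emp : Formula
  _∧ᶠ_ _∨ᶠ_ _→ᶠ_ _*ᶠ_ _-*_ : Formula → Formula → Formula
  atom : Atom → Formula

infixl 15 _,,_ _︔_

data Bunch : Set where
  form : Formula → Bunch
  ∅m ∅a : Bunch
  _,,_ _︔_ : Bunch → Bunch → Bunch

data Ctx : Set where
  hole : Ctx
  _,,ˡ_ _︔ˡ_ : Ctx → Bunch → Ctx
  _,,ʳ_ _︔ʳ_ : Bunch → Ctx → Ctx

_[_] : Ctx → Bunch → Bunch
hole [ Γ ] = Γ
(C ,,ˡ B) [ Γ ] = (C [ Γ ]) ,, B
(C ︔ˡ B) [ Γ ] = (C [ Γ ]) ︔ B
(B ,,ʳ C) [ Γ ] = B ,, (C [ Γ ])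
(B ︔ʳ C) [ Γ ] = B ︔ (C [ Γ ])

infix 10 _≡ᵇ_
data _≡ᵇ_ : Bunch → Bunch → Set where
  ≡-refl  : ∀ {Δ} → Δ ≡ᵇ Δ
  ≡-sym   : ∀ {Δ Δ'} → Δ ≡ᵇ Δ' → Δ' ≡ᵇ Δ
  ≡-trans : ∀ {Δ Δ' Δ''} → Δ ≡ᵇ Δ' → Δ' ≡ᵇ Δ'' → Δ ≡ᵇ Δ''
  ≡-ctx   : ∀ C {Δ Δ'} → Δ ≡ᵇ Δ' → C [ Δ ] ≡ᵇ C [ Δ' ]
  ,-comm  : ∀ {Δ₁ Δ₂} → (Δ₁ ,, Δ₂) ≡ᵇ (Δ₂ ,, Δ₁)
  ,-assoc : ∀ {Δ₁ Δ₂ Δ₃} → ((Δ₁ ,, Δ₂) ,, Δ₃) ≡ᵇ (Δ₁ ,, (Δ₂ ,, Δ₃))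
  ,-unit  : ∀ {Δ} → (Δ ,, ∅m) ≡ᵇ Δ
  ︔-comm  : ∀ {Δ₁ Δ₂} → (Δ₁ ︔ Δ₂) ≡ᵇ (Δ₂ ︔ Δ₁)
  ︔-assoc : ∀ {Δ₁ Δ₂ Δ₃} → ((Δ₁ ︔ Δ₂) ︔ Δ₃) ≡ᵇ (Δ₁ ︔ (Δ₂ ︔ Δ₃))
  ︔-unit  : ∀ {Δ} → (Δ ︔ ∅a) ≡ᵇ Δ

-- cut-free BI sequent calculus (all rules except (cut))
infix 5 _⊢cf_
data _⊢cf_ : Bunch → Formula → Set where
  ax    : ∀ {a} → form (atom a) ⊢cf atom a
  equiv : ∀ {Δ Δ' φ} → Δ' ⊢cf φ → Δ ≡ᵇ Δ' → Δ ⊢cf φ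
  W︔    : ∀ C {Δ₁ Δ₂ φ} → C [ Δ₁ ] ⊢cf φ → C [ Δ₁ ︔ Δ₂ ] ⊢cf φ
  C︔    : ∀ C {Δ₁ φ} → C [ Δ₁ ︔ Δ₁ ] ⊢cf φ → C [ Δ₁ ] ⊢cf φ
  empR  : ∅m ⊢cf emp
  empL  : ∀ C {φ} → C [ ∅m ] ⊢cf φ → C [ form emp ] ⊢cf φ
  *R    : ∀ {Δ₁ Δ₂ φ ψ} → Δ₁ ⊢cf φ → Δ₂ ⊢cf ψ → (Δ₁ ,, Δ₂) ⊢cf φ *ᶠ ψ
  *L    : ∀ C {φ ψ χ} → C [ form φ ,, form ψ ] ⊢cf χ → C [ form (φ *ᶠ ψ) ] ⊢cf χ
  -*R   : ∀ {Δ φ ψ} → (Δ ,, form φ) ⊢cf ψ → Δ ⊢cf φ -* ψ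
  -*L   : ∀ C {Δ₁ Δ₂ φ ψ χ} → Δ₁ ⊢cf φ → C [ Δ₂ ,, form ψ ] ⊢cf χ →
          C [ (Δ₁ ,, Δ₂) ,, form (φ -* ψ) ] ⊢cf χ
  ⊤R    : ∅a ⊢cf ⊤ᶠ
  ⊤L    : ∀ C {φ} → C [ ∅a ] ⊢cf φ → C [ form ⊤ᶠ ] ⊢cf φ
  ∧R    : ∀ {Δ₁ Δ₂ φ ψ} → Δ₁ ⊢cf φ → Δ₂ ⊢cf ψ → (Δ₁ ︔ Δ₂) ⊢cf φ ∧ᶠ ψ
  ∧L    : ∀ C {φ ψ χ} → C [ form φ ︔ form ψ ] ⊢cf χ → C [ form (φ ∧ᶠ ψ) ] ⊢cf χ
  →R    : ∀ {Δ φ ψ} → (Δ ︔ form φ) ⊢cf ψ → Δ ⊢cf φ →ᶠ ψ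
  →L    : ∀ C {Δ₁ Δ₂ φ ψ χ} → Δ₁ ⊢cf φ → C [ Δ₂ ︔ form ψ ] ⊢cf χ →
          C [ (Δ₁ ︔ Δ₂) ︔ form (φ →ᶠ ψ) ] ⊢cf χ
  ⊥L    : ∀ C {φ} → C [ form ⊥ᶠ ] ⊢cf φ
  ∨R₁   : ∀ {Δ φ ψ} → Δ ⊢cf φ → Δ ⊢cf φ ∨ᶠ ψ
  ∨R₂   : ∀ {Δ φ ψ} → Δ ⊢cf ψ → Δ ⊢cf φ ∨ᶠ ψ
  ∨L    : ∀ C {φ ψ χ} → C [ form φ ] ⊢cf χ → C [ form ψ ] ⊢cf χ →
          C [ form (φ ∨ᶠ ψ) ] ⊢cf χ

-- Sets of bunches are predicates on raw bunches. (Closed sets are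
-- automatically invariant under ≡ᵇ, so this matches subsets of Bunch/≡.)
BSet : Set₁
BSet = Pred Bunch 0ℓ

D : Formula → BSet
D φ Δ = Δ ⊢cf φ

cl : BSet → BSet
cl X Δ = ∀ φ → X ⊆ D φ → Δ ⊢cf φ

Closed : BSet → Set
Closed X = (X ⊆ cl X) × (cl X ⊆ X)

Imp : BSet → BSet → BSet
Imp X Y Δ = ∀ {Δ'} → X Δ' → Y (Δ ︔ Δ')

-- Closedness of Z is the only nontrivial part. If Δ ∈ cl Z and Δ' ∈ X, then
-- Δ ⊢ ⌜Δ'⌝ → φ for every φ with Y ⊆ D φ, where ⌜Δ'⌝ reads the bunch Δ' as a
-- formula (',' as *, ';' as ∧): indeed Γ ; Δ' ⊢ φ for all Γ ∈ Z, and the left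
-- rules fold Δ' into ⌜Δ'⌝. Cut-free, →R is invertible and the folding left
-- rules can be undone, so Δ ; Δ' ⊢ φ, and Δ ; Δ' ∈ Y since Y is closed. The
-- adjunction only needs that closed sets admit weakening and contraction.
module Submission where

open import Defs
open import Data.Product using (_×_; _,_)
open import Function.Bundles using (_⇔_; mk⇔)
open import Relation.Unary using (_⊆_; _∩_)
open import Relation.Binary.PropositionalEquality using (_≡_; refl; sym; cong; subst)

data Unfolding : Formula → Bunch → Set where
  u-form : ∀ {φ} → Unfolding φ (form φ)
  u-∧    : ∀ {φ ψ A B} → Unfolding φ A → Unfolding ψ B → Unfolding (φ ∧ᶠ ψ) (A ︔ B)
  u-*    : ∀ {φ ψ A B} → Unfolding φ A → Unfolding ψ B → Unfolding (φ *ᶠ ψ) (A ,, B)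
  u-emp  : Unfolding emp ∅m
  u-⊤    : Unfolding ⊤ᶠ ∅a

infix 8 _⇝_
data _⇝_ : Bunch → Bunch → Set where
  leaf : ∀ {φ A} → Unfolding φ A → form φ ⇝ A
  ∅m   : ∅m ⇝ ∅m
  ∅a   : ∅a ⇝ ∅a
  _,,_ : ∀ {A A' B B'} → A ⇝ A' → B ⇝ B' → (A ,, B) ⇝ (A' ,, B')
  _︔_  : ∀ {A A' B B'} → A ⇝ A' → B ⇝ B' → (A ︔ B) ⇝ (A' ︔ B')

⇝-form : ∀ {φ} → form φ ⇝ form φ
⇝-form = leaf u-form

⇝-refl : ∀ Γ → Γ ⇝ Γ
⇝-refl (form φ) = ⇝-form
⇝-refl ∅m       = ∅m
⇝-refl ∅a       = ∅a
⇝-refl (A ,, B) = ⇝-refl A ,, ⇝-refl B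
⇝-refl (A ︔ B)  = ⇝-refl A ︔ ⇝-refl B

record Split (C : Ctx) (Δ Γ' : Bunch) : Set where
  constructor split
  field
    ctx    : Ctx
    focus  : Bunch
    plug≡  : ctx [ focus ] ≡ Γ'
    ⇝-ctx  : ∀ {A B} → A ⇝ B → C [ A ] ⇝ ctx [ B ]
    ⇝-focus : Δ ⇝ focus

⇝-split : ∀ C {Δ Γ'} → C [ Δ ] ⇝ Γ' → Split C Δ Γ'
⇝-split hole r = split hole _ refl (λ s → s) r
⇝-split (C ,,ˡ B) (r ,, q) with ⇝-split C r
... | split C' Δ' eq f r' = split (C' ,,ˡ _) Δ' (cong (_,, _) eq) (λ s → f s ,, q) r'
⇝-split (C ︔ˡ B) (r ︔ q) with ⇝-split C r
... | split C' Δ' eq f r' = split (C' ︔ˡ _) Δ' (cong (_︔ _) eq) (λ s → f s ︔ q) r'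
⇝-split (B ,,ʳ C) (q ,, r) with ⇝-split C r
... | split C' Δ' eq f r' = split (_ ,,ʳ C') Δ' (cong (_ ,,_) eq) (λ s → q ,, f s) r'
⇝-split (B ︔ʳ C) (q ︔ r) with ⇝-split C r
... | split C' Δ' eq f r' = split (_ ︔ʳ C') Δ' (cong (_ ︔_) eq) (λ s → q ︔ f s) r'

record Transported (Δ Γ' : Bunch) : Set where
  constructor transported
  field
    {target} : Bunch
    ⇝-target : Δ ⇝ target
    ≡ᵇ-target : Γ' ≡ᵇ target

≡ᵇ-unfold→ : ∀ {Γ Δ Γ'} → Γ ≡ᵇ Δ → Γ ⇝ Γ' → Transported Δ Γ'
≡ᵇ-unfold← : ∀ {Γ Δ Δ'} → Γ ≡ᵇ Δ → Δ ⇝ Δ' → Transported Γ Δ'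

≡ᵇ-unfold→ ≡-refl r = transported r ≡-refl
≡ᵇ-unfold→ (≡-sym e) r = ≡ᵇ-unfold← e r
≡ᵇ-unfold→ (≡-trans e₁ e₂) r with ≡ᵇ-unfold→ e₁ r
... | transported r₁ e₁' with ≡ᵇ-unfold→ e₂ r₁
... | transported r₂ e₂' = transported r₂ (≡-trans e₁' e₂')
≡ᵇ-unfold→ (≡-ctx C e) r with ⇝-split C r
... | split C' _ eq f r' with ≡ᵇ-unfold→ e r'
... | transported r₁ e₁ = transported (f r₁) (subst (_≡ᵇ _) eq (≡-ctx C' e₁))
≡ᵇ-unfold→ ,-comm (a ,, b) = transported (b ,, a) ,-comm
≡ᵇ-unfold→ ,-assoc ((a ,, b) ,, c) = transported (a ,, (b ,, c)) ,-assoc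
≡ᵇ-unfold→ ,-unit (a ,, ∅m) = transported a ,-unit
≡ᵇ-unfold→ ︔-comm (a ︔ b) = transported (b ︔ a) ︔-comm
≡ᵇ-unfold→ ︔-assoc ((a ︔ b) ︔ c) = transported (a ︔ (b ︔ c)) ︔-assoc
≡ᵇ-unfold→ ︔-unit (a ︔ ∅a) = transported a ︔-unit

≡ᵇ-unfold← ≡-refl r = transported r ≡-refl
≡ᵇ-unfold← (≡-sym e) r = ≡ᵇ-unfold→ e r
≡ᵇ-unfold← (≡-trans e₁ e₂) r with ≡ᵇ-unfold← e₂ r
... | transported r₂ e₂' with ≡ᵇ-unfold← e₁ r₂
... | transported r₁ e₁' = transported r₁ (≡-trans e₂' e₁')
≡ᵇ-unfold← (≡-ctx C e) r with ⇝-split C r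
... | split C' _ eq f r' with ≡ᵇ-unfold← e r'
... | transported r₁ e₁ = transported (f r₁) (subst (_≡ᵇ _) eq (≡-ctx C' e₁))
≡ᵇ-unfold← ,-comm (a ,, b) = transported (b ,, a) ,-comm
≡ᵇ-unfold← ,-assoc (a ,, (b ,, c)) = transported ((a ,, b) ,, c) (≡-sym ,-assoc)
≡ᵇ-unfold← ,-unit r = transported (r ,, ∅m) (≡-sym ,-unit)
≡ᵇ-unfold← ︔-comm (a ︔ b) = transported (b ︔ a) ︔-comm
≡ᵇ-unfold← ︔-assoc (a ︔ (b ︔ c)) = transported ((a ︔ b) ︔ c) (≡-sym ︔-assoc)
≡ᵇ-unfold← ︔-unit r = transported (r ︔ ∅a) (≡-sym ︔-unit)

-- When the unfolded leaf is principal in an ∧L, *L, ⊤L or empL, that rule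
-- instance is simply dropped; all other rules commute with unfolding.
⊢cf-unfold : ∀ {Γ Γ' φ} → Γ ⊢cf φ → Γ ⇝ Γ' → Γ' ⊢cf φ
⊢cf-unfold ax (leaf u-form) = ax
⊢cf-unfold (equiv d e) r with ≡ᵇ-unfold→ e r
... | transported r' e' = equiv (⊢cf-unfold d r') e'
⊢cf-unfold (W︔ C d) r with ⇝-split C r
... | split C' _ eq f (r₁ ︔ _) = subst (_⊢cf _) eq (W︔ C' (⊢cf-unfold d (f r₁)))
⊢cf-unfold (C︔ C d) r with ⇝-split C r
... | split C' _ eq f r' = subst (_⊢cf _) eq (C︔ C' (⊢cf-unfold d (f (r' ︔ r'))))
⊢cf-unfold empR ∅m = empR
⊢cf-unfold (empL C d) r with ⇝-split C r
... | split C' _ eq f (leaf u-form) = subst (_⊢cf _) eq (empL C' (⊢cf-unfold d (f ∅m)))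
... | split C' _ eq f (leaf u-emp)  = subst (_⊢cf _) eq (⊢cf-unfold d (f ∅m))
⊢cf-unfold (*R d₁ d₂) (r₁ ,, r₂) = *R (⊢cf-unfold d₁ r₁) (⊢cf-unfold d₂ r₂)
⊢cf-unfold (*L C d) r with ⇝-split C r
... | split C' _ eq f (leaf u-form) =
  subst (_⊢cf _) eq (*L C' (⊢cf-unfold d (f (⇝-form ,, ⇝-form))))
... | split C' _ eq f (leaf (u-* a b)) =
  subst (_⊢cf _) eq (⊢cf-unfold d (f (leaf a ,, leaf b)))
⊢cf-unfold (-*R d) r = -*R (⊢cf-unfold d (r ,, ⇝-form))
⊢cf-unfold (-*L C d₁ d₂) r with ⇝-split C r
... | split C' _ eq f ((r₁ ,, r₂) ,, leaf u-form) =
  subst (_⊢cf _) eq (-*L C' (⊢cf-unfold d₁ r₁) (⊢cf-unfold d₂ (f (r₂ ,, ⇝-form))))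
⊢cf-unfold ⊤R ∅a = ⊤R
⊢cf-unfold (⊤L C d) r with ⇝-split C r
... | split C' _ eq f (leaf u-form) = subst (_⊢cf _) eq (⊤L C' (⊢cf-unfold d (f ∅a)))
... | split C' _ eq f (leaf u-⊤)    = subst (_⊢cf _) eq (⊢cf-unfold d (f ∅a))
⊢cf-unfold (∧R d₁ d₂) (r₁ ︔ r₂) = ∧R (⊢cf-unfold d₁ r₁) (⊢cf-unfold d₂ r₂)
⊢cf-unfold (∧L C d) r with ⇝-split C r
... | split C' _ eq f (leaf u-form) =
  subst (_⊢cf _) eq (∧L C' (⊢cf-unfold d (f (⇝-form ︔ ⇝-form))))
... | split C' _ eq f (leaf (u-∧ a b)) =
  subst (_⊢cf _) eq (⊢cf-unfold d (f (leaf a ︔ leaf b)))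
⊢cf-unfold (→R d) r = →R (⊢cf-unfold d (r ︔ ⇝-form))
⊢cf-unfold (→L C d₁ d₂) r with ⇝-split C r
... | split C' _ eq f ((r₁ ︔ r₂) ︔ leaf u-form) =
  subst (_⊢cf _) eq (→L C' (⊢cf-unfold d₁ r₁) (⊢cf-unfold d₂ (f (r₂ ︔ ⇝-form))))
⊢cf-unfold (⊥L C) r with ⇝-split C r
... | split C' _ eq f (leaf u-form) = subst (_⊢cf _) eq (⊥L C')
⊢cf-unfold (∨R₁ d) r = ∨R₁ (⊢cf-unfold d r)
⊢cf-unfold (∨R₂ d) r = ∨R₂ (⊢cf-unfold d r)
⊢cf-unfold (∨L C d₁ d₂) r with ⇝-split C r
... | split C' _ eq f (leaf u-form) =
  subst (_⊢cf _) eq (∨L C' (⊢cf-unfold d₁ (f ⇝-form)) (⊢cf-unfold d₂ (f ⇝-form)))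

→R-inversion : ∀ {Δ φ ψ} → Δ ⊢cf φ →ᶠ ψ → (Δ ︔ form φ) ⊢cf ψ
→R-inversion {φ = φ} (equiv d e)    = equiv (→R-inversion d) (≡-ctx (hole ︔ˡ form φ) e)
→R-inversion {φ = φ} (W︔ C d)       = W︔ (C ︔ˡ form φ) (→R-inversion d)
→R-inversion {φ = φ} (C︔ C d)       = C︔ (C ︔ˡ form φ) (→R-inversion d)
→R-inversion {φ = φ} (empL C d)     = empL (C ︔ˡ form φ) (→R-inversion d)
→R-inversion {φ = φ} (*L C d)       = *L (C ︔ˡ form φ) (→R-inversion d)
→R-inversion {φ = φ} (-*L C d₁ d₂)  = -*L (C ︔ˡ form φ) d₁ (→R-inversion d₂)
→R-inversion {φ = φ} (⊤L C d)       = ⊤L (C ︔ˡ form φ) (→R-inversion d)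
→R-inversion {φ = φ} (∧L C d)       = ∧L (C ︔ˡ form φ) (→R-inversion d)
→R-inversion         (→R d)         = d
→R-inversion {φ = φ} (→L C d₁ d₂)   = →L (C ︔ˡ form φ) d₁ (→R-inversion d₂)
→R-inversion {φ = φ} (⊥L C)         = ⊥L (C ︔ˡ form φ)
→R-inversion {φ = φ} (∨L C d₁ d₂)   = ∨L (C ︔ˡ form φ) (→R-inversion d₁) (→R-inversion d₂)

⌜_⌝ : Bunch → Formula
⌜ form φ ⌝ = φ
⌜ ∅m ⌝     = emp
⌜ ∅a ⌝     = ⊤ᶠ
⌜ A ,, B ⌝ = ⌜ A ⌝ *ᶠ ⌜ B ⌝
⌜ A ︔ B ⌝  = ⌜ A ⌝ ∧ᶠ ⌜ B ⌝

Unfolding-⌜⌝ : ∀ Γ → Unfolding ⌜ Γ ⌝ Γ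
Unfolding-⌜⌝ (form φ) = u-form
Unfolding-⌜⌝ ∅m       = u-emp
Unfolding-⌜⌝ ∅a       = u-⊤
Unfolding-⌜⌝ (A ,, B) = u-* (Unfolding-⌜⌝ A) (Unfolding-⌜⌝ B)
Unfolding-⌜⌝ (A ︔ B)  = u-∧ (Unfolding-⌜⌝ A) (Unfolding-⌜⌝ B)

infixl 20 _∘ᶜ_
_∘ᶜ_ : Ctx → Ctx → Ctx
hole      ∘ᶜ D = D
(C ,,ˡ B) ∘ᶜ D = (C ∘ᶜ D) ,,ˡ B
(C ︔ˡ B)  ∘ᶜ D = (C ∘ᶜ D) ︔ˡ B
(B ,,ʳ C) ∘ᶜ D = B ,,ʳ (C ∘ᶜ D)
(B ︔ʳ C)  ∘ᶜ D = B ︔ʳ (C ∘ᶜ D)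

∘ᶜ-plug : ∀ C D Γ → (C ∘ᶜ D) [ Γ ] ≡ C [ D [ Γ ] ]
∘ᶜ-plug hole      D Γ = refl
∘ᶜ-plug (C ,,ˡ B) D Γ = cong (_,, B) (∘ᶜ-plug C D Γ)
∘ᶜ-plug (C ︔ˡ B)  D Γ = cong (_︔ B) (∘ᶜ-plug C D Γ)
∘ᶜ-plug (B ,,ʳ C) D Γ = cong (B ,,_) (∘ᶜ-plug C D Γ)
∘ᶜ-plug (B ︔ʳ C)  D Γ = cong (B ︔_) (∘ᶜ-plug C D Γ)

under : ∀ C D {Γ Γ' φ} → ((C ∘ᶜ D) [ Γ ] ⊢cf φ → (C ∘ᶜ D) [ Γ' ] ⊢cf φ) →
        C [ D [ Γ ] ] ⊢cf φ → C [ D [ Γ' ] ] ⊢cf φ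
under C D {Γ} {Γ'} {φ} f d =
  subst (_⊢cf φ) (∘ᶜ-plug C D Γ') (f (subst (_⊢cf φ) (sym (∘ᶜ-plug C D Γ)) d))

⊢cf-fold : ∀ C Γ {φ} → C [ Γ ] ⊢cf φ → C [ form ⌜ Γ ⌝ ] ⊢cf φ
⊢cf-fold C (form φ) d = d
⊢cf-fold C ∅m       d = empL C d
⊢cf-fold C ∅a       d = ⊤L C d
⊢cf-fold C (A ,, B) d =
  *L C (under C (form ⌜ A ⌝ ,,ʳ hole) (⊢cf-fold (C ∘ᶜ (form ⌜ A ⌝ ,,ʳ hole)) B)
         (under C (hole ,,ˡ B) (⊢cf-fold (C ∘ᶜ (hole ,,ˡ B)) A) d))
⊢cf-fold C (A ︔ B) d =
  ∧L C (under C (form ⌜ A ⌝ ︔ʳ hole) (⊢cf-fold (C ∘ᶜ (form ⌜ A ⌝ ︔ʳ hole)) B)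
         (under C (hole ︔ˡ B) (⊢cf-fold (C ∘ᶜ (hole ︔ˡ B)) A) d))

⊢cf-curry : ∀ {Δ Γ φ} → (Δ ︔ Γ) ⊢cf φ → Δ ⊢cf ⌜ Γ ⌝ →ᶠ φ
⊢cf-curry {Δ} {Γ} d = →R (⊢cf-fold (Δ ︔ʳ hole) Γ d)

⊢cf-uncurry : ∀ {Δ Γ φ} → Δ ⊢cf ⌜ Γ ⌝ →ᶠ φ → (Δ ︔ Γ) ⊢cf φ
⊢cf-uncurry {Δ} {Γ} d = ⊢cf-unfold (→R-inversion d) (⇝-refl Δ ︔ leaf (Unfolding-⌜⌝ Γ))

⊆-cl : ∀ {X : BSet} → X ⊆ cl X
⊆-cl x φ X⊆Dφ = X⊆Dφ x

Closed-admissible : ∀ {Z : BSet} {Γ Γ'} → Closed Z →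
                    (∀ {φ} → Γ ⊢cf φ → Γ' ⊢cf φ) → Z Γ → Z Γ'
Closed-admissible (Z⊆clZ , clZ⊆Z) rule z = clZ⊆Z λ φ Z⊆Dφ → rule (Z⊆clZ z φ Z⊆Dφ)

Imp-closed : ∀ {X Y : BSet} → Closed Y → Closed (Imp X Y)
Imp-closed {X} {Y} (_ , clY⊆Y) = ⊆-cl , cl-Imp⊆Imp
  where
  cl-Imp⊆Imp : cl (Imp X Y) ⊆ Imp X Y
  cl-Imp⊆Imp {Δ} Δ∈cl {Γ} Γ∈X = clY⊆Y λ φ Y⊆Dφ →
    ⊢cf-uncurry (Δ∈cl (⌜ Γ ⌝ →ᶠ φ) λ Δ'∈Imp → ⊢cf-curry (Y⊆Dφ (Δ'∈Imp Γ∈X)))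

Imp-adjoint : ∀ {X Y W : BSet} → Closed X → Closed Y → Closed W →
              (W ∩ X) ⊆ Y ⇔ W ⊆ Imp X Y
Imp-adjoint hX hY hW = mk⇔
  (λ W∩X⊆Y {_} w {_} x → W∩X⊆Y (Closed-admissible hW (W︔ hole) w ,
                                Closed-admissible hX (λ d → equiv (W︔ hole d) ︔-comm) x))
  (λ W⊆Imp {_} (w , x) → Closed-admissible hY (C︔ hole) (W⊆Imp w x))

proposition6p5 : (X Y : BSet) → Closed X → Closed Y →
    Closed (Imp X Y) × ((W : BSet) → Closed W → ((W ∩ X) ⊆ Y ⇔ W ⊆ Imp X Y))
proposition6p5 X Y hX hY = Imp-closed hY , λ W hW → Imp-adjoint hX hY hW
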